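{- Let $G$ be a graph. (1) If $v$ is a universal vertex of $G$, then $cow(G)=cow(G-v)$. (2) Suppose $G$ has no universal vertex, and let $u,v$ be two vertices of $G$ with $N(u)=N(v)$. Then $cow(G)=cow(G-u)+1$ if $v$ is universal in $G-u$, and $cow(G)=cow(G-u)$ otherwise.
   Context: All graphs are finite, simple and undirected. $N(v)$ denotes the set of neighbours of $v$; a vertex $v$ is universal if $N(v)\cup\{v\}=V(G)$; $G-v$ is the graph obtained by deleting $v$. For a graph $G=(V,E)$, the complete width $cow(G)$ is the minimum $k\ge 0$ such that there exist $k$ independent sets $N_1,\dots,N_k\subseteq V$ with the property that for every two distinct non-adjacent vertices $x,y$ of $G$ there is an $i$ with $x,y\in N_i$. -}

module Defs where

open import Data.Nat using (ℕ; suc; _≤_)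
open import Data.Bool using (Bool; true; false)
open import Data.Fin using (Fin; punchIn)
open import Data.Fin.Subset using (Subset; _∈_)
open import Data.Product using (Σ; ∃; _×_; _,_)
open import Relation.Nullary using (¬_)
open import Relation.Binary.PropositionalEquality using (_≡_; _≢_)

record Graph (n : ℕ) : Set where
  field
    adj    : Fin n → Fin n → Bool
    sym    : ∀ x y → adj x y ≡ adj y x
    irrefl : ∀ x → adj x x ≡ false
open Graph public

_-_ : ∀ {n} → Graph (suc n) → Fin (suc n) → Graph n
adj    (G - v) x y = adj G (punchIn v x) (punchIn v y)
sym    (G - v) x y = sym G (punchIn v x) (punchIn v y)
irrefl (G - v) x   = irrefl G (punchIn v x)

Universal : ∀ {n} → Graph n → Fin n → Set
Universal G v = ∀ w → w ≢ v → adj G v w ≡ true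

SameNeighbourhood : ∀ {n} → Graph n → Fin n → Fin n → Set
SameNeighbourhood G u v = ∀ w → adj G u w ≡ adj G v w

Independent : ∀ {n} → Graph n → Subset n → Set
Independent G S = ∀ x y → x ∈ S → y ∈ S → adj G x y ≡ false

CompleteCover : ∀ {n} → Graph n → ℕ → Set
CompleteCover {n} G k =
  Σ (Fin k → Subset n) λ N →
    (∀ i → Independent G (N i)) ×
    (∀ x y → x ≢ y → adj G x y ≡ false → ∃ λ i → x ∈ N i × y ∈ N i)

IsCow : ∀ {n} → Graph n → ℕ → Set
IsCow G k = CompleteCover G k × (∀ m → CompleteCover G m → k ≤ m)

-- Deleting a vertex u restricts every complete cover of G to one of G - u of the same size;
-- conversely a cover of G - u extends to G by putting u into some of its sets, which works
-- whenever the sets receiving u are non-adjacent to u and together meet every non-neighbour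
-- of u. For a universal u no set receives u. For a twin u of v (N(u) = N(v)) u joins exactly
-- the sets containing v, and some set contains v as soon as v is not universal in G - u. If v
-- is universal in G - u, the pair {u, v} needs a set of its own: the extension pays for the
-- extra set {v}, and conversely the set covering {u, v} contains nothing else and can be dropped.
module Submission where

open import Defs hiding (sym)
open import Data.Nat using (suc; zero; s≤s)
open import Data.Nat.Properties using (≤-antisym)
open import Data.Bool using (Bool; true; false)
open import Data.Bool.Properties using (¬-not) renaming (_≟_ to _≟ᵇ_)
open import Data.Fin using (Fin; punchIn; punchOut)
open import Data.Fin.Properties
  using (punchIn-punchOut; punchOut-punchIn; punchInᵢ≢i; punchIn-injective; ¬∀⟶∃¬)
  renaming (_≟_ to _≟ᶠ_)
open import Data.Fin.Subset using (Subset; _∈_; ⁅_⁆)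
open import Data.Fin.Subset.Properties using (x∈⁅x⁆; x∈⁅y⁆⇒x≡y)
open import Data.Vec using (Vec; lookup; insertAt; removeAt)
open import Data.Vec.Properties
  using (insertAt-lookup; insertAt-punchIn; removeAt-punchOut; []=⇒lookup; lookup⇒[]=)
open import Data.Product using (∃; _×_; _,_; proj₁)
open import Function using (_∘_)
open import Relation.Nullary using (¬_; yes; no; Dec; contradiction)
open import Relation.Binary.PropositionalEquality

true≢false : true ≢ false
true≢false ()

∈-resp-lookup : ∀ {m n} {S : Subset m} {T : Subset n} {x y} →
  lookup S x ≡ lookup T y → x ∈ S → y ∈ T
∈-resp-lookup {T = T} {y = y} eq x∈S = lookup⇒[]= y T (trans (sym eq) ([]=⇒lookup x∈S))

lookup-removeAt-punchIn : ∀ {n} {A : Set} (xs : Vec A (suc n)) i j →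
  lookup (removeAt xs i) j ≡ lookup xs (punchIn i j)
lookup-removeAt-punchIn xs i j = begin
  lookup (removeAt xs i) j                    ≡⟨ cong (lookup (removeAt xs i)) (sym (punchOut-punchIn i)) ⟩
  lookup (removeAt xs i) (punchOut i≢punchIn) ≡⟨ removeAt-punchOut xs i≢punchIn ⟩
  lookup xs (punchIn i j)                     ∎
  where
  open ≡-Reasoning
  i≢punchIn : i ≢ punchIn i j
  i≢punchIn = punchInᵢ≢i i j ∘ sym

data PunchInView {n} (u : Fin (suc n)) : Fin (suc n) → Set where
  at      : PunchInView u u
  punched : ∀ x → PunchInView u (punchIn u x)

punchInView : ∀ {n} (u x : Fin (suc n)) → PunchInView u x
punchInView u x with u ≟ᶠ x
... | yes refl = at
... | no u≢x   = subst (PunchInView u) (punchIn-punchOut u≢x) (punched (punchOut u≢x))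

universal-non-neighbour : ∀ {n} (G : Graph n) {v w} →
  Universal G v → adj G v w ≡ false → w ≡ v
universal-non-neighbour G {v} {w} univ nadj with w ≟ᶠ v
... | yes w≡v = w≡v
... | no w≢v  = contradiction (trans (sym (univ w w≢v)) nadj) true≢false

¬Universal⇒non-neighbour : ∀ {n} (G : Graph n) {v} →
  ¬ Universal G v → ∃ λ w → w ≢ v × adj G v w ≡ false
¬Universal⇒non-neighbour {n} G {v} ¬univ with ¬∀⟶∃¬ n _ adjacent-if-distinct? ¬univ
  where
  adjacent-if-distinct? : ∀ w → Dec (w ≢ v → adj G v w ≡ true)
  adjacent-if-distinct? w with w ≟ᶠ v | adj G v w ≟ᵇ true
  ... | yes w≡v | _        = yes λ w≢v → contradiction w≡v w≢v
  ... | no _    | yes adj≡ = yes λ _ → adj≡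
  ... | no w≢v  | no adj≢  = no λ f → adj≢ (f w≢v)
... | w , ¬adjacent = w , w≢v , ¬-not λ adj≡ → ¬adjacent λ _ → adj≡
  where
  w≢v : w ≢ v
  w≢v w≡v = ¬adjacent λ w≢v → contradiction w≡v w≢v

⁅⁆-independent : ∀ {n} (G : Graph n) v → Independent G ⁅ v ⁆
⁅⁆-independent G v x y x∈ y∈ rewrite x∈⁅y⁆⇒x≡y v x∈ | x∈⁅y⁆⇒x≡y v y∈ = irrefl G v

¬CompleteCover-0 : ∀ {n} (G : Graph n) {x y} → x ≢ y → adj G x y ≡ false → ¬ CompleteCover G 0
¬CompleteCover-0 G x≢y nadj (_ , _ , cov) with cov _ _ x≢y nadj
... | () , _

CompleteCover-∷ : ∀ {n k} (G : Graph n) {S} →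
  Independent G S → CompleteCover G k → CompleteCover G (suc k)
CompleteCover-∷ G {S} indS (N , ind , cov) = N′ , ind′ , cov′
  where
  N′ : Fin (suc _) → Subset _
  N′ Fin.zero    = S
  N′ (Fin.suc i) = N i
  ind′ : ∀ i → Independent G (N′ i)
  ind′ Fin.zero    = indS
  ind′ (Fin.suc i) = ind i
  cov′ : ∀ x y → x ≢ y → adj G x y ≡ false → ∃ λ i → x ∈ N′ i × y ∈ N′ i
  cov′ x y x≢y nadj with cov x y x≢y nadj
  ... | i , x∈ , y∈ = Fin.suc i , x∈ , y∈

non-neighbour-covered : ∀ {n k} (G : Graph n) {v} → ¬ Universal G v →
  ((N , _) : CompleteCover G k) → ∃ λ i → v ∈ N i
non-neighbour-covered G ¬univ (_ , _ , cov) with ¬Universal⇒non-neighbour G ¬univ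
... | w , w≢v , nadj with cov _ w (w≢v ∘ sym) nadj
...   | i , v∈ , _ = i , v∈

module Deletion {n} (G : Graph (suc n)) (u : Fin (suc n)) where

  punchIn-≢ : ∀ {x y} → x ≢ y → punchIn u x ≢ punchIn u y
  punchIn-≢ x≢y = x≢y ∘ punchIn-injective u _ _

  CompleteCover-deleteAlong : ∀ {k m} ((N , _) : CompleteCover G k) (σ : Fin m → Fin k) →
    (∀ x y → x ≢ y → adj (G - u) x y ≡ false →
       ∃ λ j → punchIn u x ∈ N (σ j) × punchIn u y ∈ N (σ j)) →
    CompleteCover (G - u) m
  CompleteCover-deleteAlong (N , ind , _) σ cov =
    (λ j → removeAt (N (σ j)) u) ,
    (λ j x y x∈ y∈ → ind (σ j) _ _ (restrict⁻ x∈) (restrict⁻ y∈)) ,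
    (λ x y x≢y nadj → let j , x∈ , y∈ = cov x y x≢y nadj in j , restrict⁺ x∈ , restrict⁺ y∈)
    where
    restrict⁺ : ∀ {S x} → punchIn u x ∈ S → x ∈ removeAt S u
    restrict⁺ {S} {x} = ∈-resp-lookup (sym (lookup-removeAt-punchIn S u x))
    restrict⁻ : ∀ {S x} → x ∈ removeAt S u → punchIn u x ∈ S
    restrict⁻ {S} {x} = ∈-resp-lookup (lookup-removeAt-punchIn S u x)

  CompleteCover-delete : ∀ {k} → CompleteCover G k → CompleteCover (G - u) k
  CompleteCover-delete C@(_ , _ , cov) = CompleteCover-deleteAlong C (λ j → j)
    λ x y x≢y nadj → cov _ _ (punchIn-≢ x≢y) nadj

  -- Any pair covered only by N i lies inside N i, hence is not a pair of distinct vertices of G - u.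
  CompleteCover-deleteSet : ∀ {k} ((N , _) : CompleteCover G (suc k)) i →
    (∀ x y → punchIn u x ∈ N i → punchIn u y ∈ N i → x ≡ y) →
    CompleteCover (G - u) k
  CompleteCover-deleteSet C@(N , _ , cov) i unique =
    CompleteCover-deleteAlong C (punchIn i) coveredElsewhere
    where
    coveredElsewhere : ∀ x y → x ≢ y → adj (G - u) x y ≡ false →
      ∃ λ j → punchIn u x ∈ N (punchIn i j) × punchIn u y ∈ N (punchIn i j)
    coveredElsewhere x y x≢y nadj with cov _ _ (punchIn-≢ x≢y) nadj
    ... | j , x∈ , y∈ with i ≟ᶠ j
    ...   | yes refl = contradiction (unique x y x∈ y∈) x≢y
    ...   | no i≢j   = punchOut i≢j ,
                       subst (λ t → punchIn u x ∈ N t) (sym (punchIn-punchOut i≢j)) x∈ ,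
                       subst (λ t → punchIn u y ∈ N t) (sym (punchIn-punchOut i≢j)) y∈

  CompleteCover-insert : ∀ {k} ((T , _) : CompleteCover (G - u) k) (b : Fin k → Bool) →
    (∀ i y → b i ≡ true → y ∈ T i → adj G u (punchIn u y) ≡ false) →
    (∀ y → adj G u (punchIn u y) ≡ false → ∃ λ i → b i ≡ true × y ∈ T i) →
    CompleteCover G k
  CompleteCover-insert (T , indT , covT) b apart reach = N , ind , cov
    where
    N : Fin _ → Subset (suc n)
    N i = insertAt (T i) u (b i)

    u∈⇒b : ∀ {i} → u ∈ N i → b i ≡ true
    u∈⇒b {i} u∈ = trans (sym (insertAt-lookup (T i) u (b i))) ([]=⇒lookup u∈)
    b⇒u∈ : ∀ {i} → b i ≡ true → u ∈ N i
    b⇒u∈ {i} bi = lookup⇒[]= u (N i) (trans (insertAt-lookup (T i) u (b i)) bi)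
    lift⁻ : ∀ {i x} → punchIn u x ∈ N i → x ∈ T i
    lift⁻ {i} {x} = ∈-resp-lookup (insertAt-punchIn (T i) u (b i) x)
    lift⁺ : ∀ {i x} → x ∈ T i → punchIn u x ∈ N i
    lift⁺ {i} {x} = ∈-resp-lookup (sym (insertAt-punchIn (T i) u (b i) x))

    ind : ∀ i → Independent G (N i)
    ind i x y x∈ y∈ with punchInView u x | punchInView u y
    ... | at         | at         = irrefl G u
    ... | at         | punched y′ = apart i y′ (u∈⇒b x∈) (lift⁻ y∈)
    ... | punched x′ | at         = trans (Graph.sym G _ u) (apart i x′ (u∈⇒b y∈) (lift⁻ x∈))
    ... | punched x′ | punched y′ = indT i x′ y′ (lift⁻ x∈) (lift⁻ y∈)

    cov : ∀ x y → x ≢ y → adj G x y ≡ false → ∃ λ i → x ∈ N i × y ∈ N i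
    cov x y x≢y nadj with punchInView u x | punchInView u y
    ... | at         | at         = contradiction refl x≢y
    ... | at         | punched y′ = let i , bi , y∈ = reach y′ nadj in i , b⇒u∈ bi , lift⁺ y∈
    ... | punched x′ | at         =
      let i , bi , x∈ = reach x′ (trans (Graph.sym G u _) nadj) in i , lift⁺ x∈ , b⇒u∈ bi
    ... | punched x′ | punched y′ =
      let i , x∈ , y∈ = covT x′ y′ (x≢y ∘ cong (punchIn u)) nadj in i , lift⁺ x∈ , lift⁺ y∈

IsCow-≡ : ∀ {m n} (G : Graph m) (H : Graph n) →
  (∀ {k} → CompleteCover H k → CompleteCover G k) →
  (∀ {k} → CompleteCover G k → CompleteCover H k) →
  ∀ {a b} → IsCow G a → IsCow H b → a ≡ b
IsCow-≡ _ _ lift restrict (ca , mina) (cb , minb) = ≤-antisym (mina _ (lift cb)) (minb _ (restrict ca))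

IsCow-≡-suc : ∀ {m n} (G : Graph m) (H : Graph n) → ¬ CompleteCover G 0 →
  (∀ {k} → CompleteCover H k → CompleteCover G (suc k)) →
  (∀ {k} → CompleteCover G (suc k) → CompleteCover H k) →
  ∀ {a b} → IsCow G a → IsCow H b → a ≡ suc b
IsCow-≡-suc _ _ ¬cover0 lift restrict {zero}  (ca , _)    _            = contradiction ca ¬cover0
IsCow-≡-suc _ _ ¬cover0 lift restrict {suc a} (ca , mina) (cb , minb) =
  ≤-antisym (mina _ (lift cb)) (s≤s (minb _ (restrict ca)))

module _ {n} (G : Graph (suc n)) where
  open Deletion G

  CompleteCover-insertUniversal : ∀ {u k} → Universal G u →
    CompleteCover (G - u) k → CompleteCover G k
  CompleteCover-insertUniversal {u} univ C = CompleteCover-insert u C (λ _ → false) (λ _ _ ())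
    λ y nadj → contradiction (trans (sym (univ _ (punchInᵢ≢i u y))) nadj) true≢false

  module Twins (u : Fin (suc n)) (v : Fin n) (same : SameNeighbourhood G u (punchIn u v)) where

    u≁v : adj G u (punchIn u v) ≡ false
    u≁v = trans (same _) (irrefl G _)

    u≁⇒v≁ : ∀ {y} → adj G u (punchIn u y) ≡ false → adj (G - u) v y ≡ false
    u≁⇒v≁ nadj = trans (sym (same _)) nadj

    CompleteCover-insertTwin : ∀ {k} → ¬ Universal (G - u) v →
      CompleteCover (G - u) k → CompleteCover G k
    CompleteCover-insertTwin ¬univ C@(T , indT , covT) =
      CompleteCover-insert u C (λ i → lookup (T i) v)
        (λ i y v∈ y∈ → trans (same _) (indT i v y (lookup⇒[]= v (T i) v∈) y∈))
        reach
      where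
      reach : ∀ y → adj G u (punchIn u y) ≡ false → ∃ λ i → lookup (T i) v ≡ true × y ∈ T i
      reach y nadj with y ≟ᶠ v
      ... | yes refl = let i , v∈ = non-neighbour-covered (G - u) ¬univ C in i , []=⇒lookup v∈ , v∈
      ... | no y≢v   = let i , v∈ , y∈ = covT v y (y≢v ∘ sym) (u≁⇒v≁ nadj) in i , []=⇒lookup v∈ , y∈

    module _ (univ : Universal (G - u) v) where

      CompleteCover-insertTwinPair : ∀ {k} → CompleteCover (G - u) k → CompleteCover G (suc k)
      CompleteCover-insertTwinPair C = CompleteCover-insert u C′ isNew apart reach
        where
        C′ : CompleteCover (G - u) (suc _)
        C′ = CompleteCover-∷ (G - u) (⁅⁆-independent (G - u) v) C
        isNew : Fin (suc _) → Bool
        isNew Fin.zero    = true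
        isNew (Fin.suc _) = false
        apart : ∀ i y → isNew i ≡ true → y ∈ proj₁ C′ i →
          adj G u (punchIn u y) ≡ false
        apart Fin.zero    y _  y∈ rewrite x∈⁅y⁆⇒x≡y v y∈ = u≁v
        apart (Fin.suc _) _ () _
        reach : ∀ y → adj G u (punchIn u y) ≡ false →
          ∃ λ i → isNew i ≡ true × y ∈ proj₁ C′ i
        reach y nadj rewrite universal-non-neighbour (G - u) univ (u≁⇒v≁ nadj) =
          Fin.zero , refl , x∈⁅x⁆ v

      CompleteCover-deleteTwinPair : ∀ {k} → CompleteCover G (suc k) → CompleteCover (G - u) k
      CompleteCover-deleteTwinPair C@(N , ind , cov) with cov u _ (punchInᵢ≢i u v ∘ sym) u≁v
      ... | i , u∈ , _ = CompleteCover-deleteSet u C i λ x y x∈ y∈ → trans (onlyTwin x∈) (sym (onlyTwin y∈))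
        where
        onlyTwin : ∀ {x} → punchIn u x ∈ N i → x ≡ v
        onlyTwin x∈ = universal-non-neighbour (G - u) univ (u≁⇒v≁ (ind i u _ u∈ x∈))

proposition2 :
    (∀ {n} (G : Graph (suc n)) (v : Fin (suc n)) → Universal G v →
       ∀ a b → IsCow G a → IsCow (G - v) b → a ≡ b)
    ×
    (∀ {n} (G : Graph (suc n)) (u : Fin (suc n)) (v : Fin n) →
       (∀ w → ¬ Universal G w) →
       SameNeighbourhood G u (punchIn u v) →
       (Universal (G - u) v → ∀ a b → IsCow G a → IsCow (G - u) b → a ≡ suc b)
       ×
       (¬ Universal (G - u) v → ∀ a b → IsCow G a → IsCow (G - u) b → a ≡ b))
proposition2 =
  (λ G v univ _ _ → IsCow-≡ G (G - v) (CompleteCover-insertUniversal G univ) (Deletion.CompleteCover-delete G v)) ,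
  λ G u v _ same → let open Twins G u v same in
    (λ univ _ _ → IsCow-≡-suc G (G - u) (¬CompleteCover-0 G (punchInᵢ≢i u v ∘ sym) u≁v)
                    (CompleteCover-insertTwinPair univ) (CompleteCover-deleteTwinPair univ)) ,
    (λ ¬univ _ _ → IsCow-≡ G (G - u) (CompleteCover-insertTwin ¬univ) (Deletion.CompleteCover-delete G u))
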